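{- Let $\mathcal{C}=(S,\Delta,r)$ be a semimatroid, and let $M$ be the matroid on $S$ with rank function $r'(\sigma)=\max\{r(\tau):\tau\subseteq\sigma,\ \tau\in\Delta\}$. Then $\Delta$ is a strong pseudo-independence complex over $M$.
   Context: A semimatroid is a triple $(S,\Delta,r)$ with $S$ finite, $\Delta$ a non-void simplicial complex over $S$ (family of subsets of $S$ closed under subsets), and $r:\Delta\to\mathbb{N}$ such that for all $\sigma,\tau\in\Delta$: (i) $0\le r(\sigma)\le|\sigma|$; (ii) $\sigma\subseteq\tau\Rightarrow r(\sigma)\le r(\tau)$; (iii) if $\sigma\cup\tau\in\Delta$ then $r(\sigma)+r(\tau)\ge r(\sigma\cup\tau)+r(\sigma\cap\tau)$; (iv) if $r(\sigma)=r(\sigma\cap\tau)$ then $\sigma\cup\tau\in\Delta$; (v) if $r(\sigma)<r(\tau)$ there is $y\in\tau\setminus\sigma$ with $\sigma\cup\{y\}\in\Delta$. Let $M$ be a matroid on $S$ with rank function $\rho$, and $\Delta$ a simplicial complex over $S$. $\Delta$ is a pseudo-independence complex over $M$ if whenever $\sigma\in\Delta$, $x\in S\setminus\sigma$ and $\rho(\sigma\cup\{x\})>\rho(\sigma)$, then $\sigma\cup\{x\}\in\Delta$. It is a strong pseudo-independence complex over $M$ if in addition, whenever $\sigma\in\Delta$, $x\in S\setminus\sigma$, $\rho(\sigma\cup\{x\})=\rho(\sigma)$ and $\sigma\cup\{x\}\in\Delta$, then $x$ is a cone point of $\mathrm{lk}_\sigma(\Delta)=\{\tau:\tau\cap\sigma=\emptyset,\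 \tau\cup\sigma\in\Delta\}$, i.e. $\tau\cup\{x\}\in\mathrm{lk}_\sigma(\Delta)$ for every $\tau\in\mathrm{lk}_\sigma(\Delta)$. -}

module Defs where

open import Data.Nat using (ℕ; _≤_; _<_; _+_; _⊔_)
open import Data.Bool using (Bool; true; false)
open import Data.Fin using (Fin)
open import Data.Fin.Subset using (Subset; _∈_; _∉_; _⊆_; _∪_; _∩_; ⁅_⁆; ∣_∣; ⊥)
open import Data.Fin.Subset.Properties using (_⊆?_)
open import Data.List using (List; []; _∷_; map; _++_; foldr)
open import Data.Vec using (_∷_; [])
open import Data.Product using (Σ; ∃; _×_; _,_)
open import Relation.Nullary using (Dec; yes; no; ¬_)
open import Relation.Unary using (Pred; Decidable)
open import Relation.Binary.PropositionalEquality using (_≡_)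
open import Level using (0ℓ)

record IsSimplicialComplex {n : ℕ} (Δ : Subset n → Set) : Set where
  field
    nonvoid      : ∃ λ σ → Δ σ
    down-closed  : ∀ {σ τ} → σ ⊆ τ → Δ τ → Δ σ

-- Semimatroid (S, Δ, r).  The rank function r is given as a function on all
-- subsets, but only its values on faces of Δ are ever used.
record IsSemimatroid {n : ℕ} (Δ : Subset n → Set) (r : Subset n → ℕ) : Set where
  field
    complex : IsSimplicialComplex Δ
    R1 : ∀ σ → Δ σ → r σ ≤ ∣ σ ∣
    R2 : ∀ σ τ → Δ σ → Δ τ → σ ⊆ τ → r σ ≤ r τ
    R3 : ∀ σ τ → Δ σ → Δ τ → Δ (σ ∪ τ) → r (σ ∪ τ) + r (σ ∩ τ) ≤ r σ + r τ
    R4 : ∀ σ τ → Δ σ → Δ τ → r σ ≡ r (σ ∩ τ) → Δ (σ ∪ τ)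
    R5 : ∀ σ τ → Δ σ → Δ τ → r σ < r τ →
         ∃ λ y → y ∈ τ × y ∉ σ × Δ (σ ∪ ⁅ y ⁆)

allSubsets : (n : ℕ) → List (Subset n)
allSubsets ℕ.zero = [] ∷ []
allSubsets (ℕ.suc n) = map (true ∷_) (allSubsets n) ++ map (false ∷_) (allSubsets n)

-- r'(σ) = max { r(τ) : τ ⊆ σ, τ ∈ Δ }   (max of the empty family is 0,
-- which never occurs since ∅ ∈ Δ).
induced-rank : {n : ℕ} (Δ : Subset n → Set) → Decidable Δ →
               (r : Subset n → ℕ) → Subset n → ℕ
induced-rank {n} Δ Δ? r σ = foldr step 0 (allSubsets n)
  where
  step : Subset n → ℕ → ℕ
  step τ acc with τ ⊆? σ | Δ? τ
  ... | yes _ | yes _ = r τ ⊔ acc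
  ... | _     | _     = acc

link : {n : ℕ} (Δ : Subset n → Set) → Subset n → Subset n → Set
link Δ σ τ = (τ ∩ σ ≡ ⊥) × Δ (τ ∪ σ)

IsConePoint : {n : ℕ} (K : Subset n → Set) → Fin n → Set
IsConePoint K x = ∀ τ → K τ → K (τ ∪ ⁅ x ⁆)

IsPseudoIndependenceComplex : {n : ℕ} (ρ : Subset n → ℕ) (Δ : Subset n → Set) → Set
IsPseudoIndependenceComplex ρ Δ =
  IsSimplicialComplex Δ ×
  (∀ σ x → Δ σ → x ∉ σ → ρ σ < ρ (σ ∪ ⁅ x ⁆) → Δ (σ ∪ ⁅ x ⁆))

IsStrongPseudoIndependenceComplex : {n : ℕ} (ρ : Subset n → ℕ) (Δ : Subset n → Set) → Set
IsStrongPseudoIndependenceComplex ρ Δ =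
  IsPseudoIndependenceComplex ρ Δ ×
  (∀ σ x → Δ σ → x ∉ σ → ρ (σ ∪ ⁅ x ⁆) ≡ ρ σ → Δ (σ ∪ ⁅ x ⁆) →
     IsConePoint (link Δ σ) x)

-- The induced rank r' agrees with r on faces, since r is monotone on Δ.
-- If r'(σ) < r'(σ ∪ x) for a face σ, a face τ ⊆ σ ∪ x realising r'(σ ∪ x) has
-- larger rank than σ, so axiom (v) adds to σ an element of τ ∖ σ, which can only be x.
-- If σ ∪ x is a face with r'(σ ∪ x) = r'(σ), it has the same rank as its
-- intersection with any face β ⊇ σ, so axiom (iv) makes (σ ∪ x) ∪ β a face;
-- taking β = τ ∪ σ for τ in the link shows that x is a cone point.
module Submission where

open import Defs
open import Data.Nat using (ℕ; suc; _≤_; _<_; _⊔_; z≤n)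
open import Data.Nat.Properties using (≤-refl; ≤-trans; ≤-reflexive; ≤-antisym; ≤-total; <-≤-trans; n≮0; ⊔-lub; m≤m⊔n; m≤n⊔m)
open import Data.Bool using (true; false)
open import Data.Fin using (Fin)
open import Data.Fin.Subset using (Subset; _⊆_; _∈_; _∉_; _∪_; _∩_; ⁅_⁆; ⊥)
open import Data.Fin.Subset.Properties using (_⊆?_; ⊆-refl; ⊆-trans; ⊆-antisym; ⊆-min; x∈⁅y⁆⇒x≡y; p⊆p∪q; q⊆p∪q; p∩q⊆p; x∈p∩q⁺; x∈p∩q⁻; x∈p∪q⁻; ∩-distribʳ-∪; ∪-identityˡ)
open import Data.List using ([]; _∷_; foldr; map)
import Data.List.Membership.Propositional as List
open import Data.List.Membership.Propositional.Properties using (∈-map⁺; ∈-++⁺ˡ; ∈-++⁺ʳ)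
open import Data.List.Relation.Unary.Any using (here; there)
open import Data.Product using (∃; _×_; _,_; proj₁)
open import Data.Sum using (_⊎_; inj₁; inj₂)
open import Data.Vec using (_∷_; [])
open import Relation.Nullary using (yes; no; contradiction)
open import Relation.Unary using (Decidable)
open import Relation.Binary.PropositionalEquality using (_≡_; refl; sym; subst; cong₂; module ≡-Reasoning)

∪-lub : ∀ {n} {p q s : Subset n} → p ⊆ s → q ⊆ s → p ∪ q ⊆ s
∪-lub {p = p} {q} p⊆s q⊆s x∈p∪q with x∈p∪q⁻ p q x∈p∪q
... | inj₁ x∈p = p⊆s x∈p
... | inj₂ x∈q = q⊆s x∈q

∩-glb : ∀ {n} {p q s : Subset n} → s ⊆ p → s ⊆ q → s ⊆ p ∩ q
∩-glb s⊆p s⊆q x∈s = x∈p∩q⁺ (s⊆p x∈s , s⊆q x∈s)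

x∉p⇒⁅x⁆∩p≡⊥ : ∀ {n} {x : Fin n} {p : Subset n} → x ∉ p → ⁅ x ⁆ ∩ p ≡ ⊥
x∉p⇒⁅x⁆∩p≡⊥ {x = x} {p} x∉p = ⊆-antisym ⁅x⁆∩p⊆⊥ (⊆-min _)
  where
  ⁅x⁆∩p⊆⊥ : ⁅ x ⁆ ∩ p ⊆ ⊥
  ⁅x⁆∩p⊆⊥ y∈⁅x⁆∩p with x∈p∩q⁻ ⁅ x ⁆ p y∈⁅x⁆∩p
  ... | y∈⁅x⁆ , y∈p = contradiction (subst (_∈ p) (x∈⁅y⁆⇒x≡y x y∈⁅x⁆) y∈p) x∉p

allSubsets-complete : ∀ {n} (p : Subset n) → p List.∈ allSubsets n
allSubsets-complete [] = here refl
allSubsets-complete {suc n} (true ∷ p) =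
  ∈-++⁺ˡ (∈-map⁺ (true ∷_) (allSubsets-complete p))
allSubsets-complete {suc n} (false ∷ p) =
  ∈-++⁺ʳ (map (true ∷_) (allSubsets n)) (∈-map⁺ (false ∷_) (allSubsets-complete p))

module InducedRankFold {n} (Δ : Subset n → Set) (Δ? : Decidable Δ) (r : Subset n → ℕ) (σ : Subset n) where

  -- The where-bound step function of induced-rank is not in scope; unification recovers it.
  private
    unfolded : ∃ λ f → induced-rank Δ Δ? r σ ≡ foldr f 0 (allSubsets n)
    unfolded = _ , refl

  step : Subset n → ℕ → ℕ
  step = proj₁ unfolded

  step-inflationary : ∀ τ acc → acc ≤ step τ acc
  step-inflationary τ acc with τ ⊆? σ | Δ? τ
  ... | yes _ | yes _ = m≤n⊔m (r τ) acc
  ... | yes _ | no _  = ≤-refl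
  ... | no _  | _     = ≤-refl

  fold-upper : ∀ {τ} L → τ List.∈ L → τ ⊆ σ → Δ τ → r τ ≤ foldr step 0 L
  fold-upper (τ ∷ L) (here refl) τ⊆σ Δτ with τ ⊆? σ | Δ? τ
  ... | yes _ | yes _   = m≤m⊔n (r τ) _
  ... | yes _ | no ¬Δτ  = contradiction Δτ ¬Δτ
  ... | no τ⊈σ | _      = contradiction (λ {x} → τ⊆σ {x}) τ⊈σ
  fold-upper (τ′ ∷ L) (there τ∈L) τ⊆σ Δτ =
    ≤-trans (fold-upper L τ∈L τ⊆σ Δτ) (step-inflationary τ′ (foldr step 0 L))

  fold-attained : ∀ L → foldr step 0 L ≡ 0 ⊎ ∃ λ τ → τ ⊆ σ × Δ τ × foldr step 0 L ≤ r τ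
  fold-attained [] = inj₁ refl
  fold-attained (τ ∷ L) with τ ⊆? σ | Δ? τ | fold-attained L
  ... | no _     | _       | ih = ih
  ... | yes _    | no _    | ih = ih
  ... | yes τ⊆σ  | yes Δτ  | inj₁ acc≡0 =
    inj₂ (τ , τ⊆σ , Δτ , ⊔-lub ≤-refl (≤-trans (≤-reflexive acc≡0) z≤n))
  ... | yes τ⊆σ  | yes Δτ  | inj₂ (τ′ , τ′⊆σ , Δτ′ , acc≤rτ′) with ≤-total (r τ) (r τ′)
  ...   | inj₁ rτ≤rτ′ = inj₂ (τ′ , τ′⊆σ , Δτ′ , ⊔-lub rτ≤rτ′ acc≤rτ′)
  ...   | inj₂ rτ′≤rτ = inj₂ (τ , τ⊆σ , Δτ , ⊔-lub ≤-refl (≤-trans acc≤rτ′ rτ′≤rτ))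

module _ {n} (Δ : Subset n → Set) (Δ? : Decidable Δ) (r : Subset n → ℕ) where

  induced-rank-upper : ∀ {σ τ} → τ ⊆ σ → Δ τ → r τ ≤ induced-rank Δ Δ? r σ
  induced-rank-upper {σ} {τ} =
    InducedRankFold.fold-upper Δ Δ? r σ (allSubsets n) (allSubsets-complete τ)

  induced-rank-attained : ∀ σ → induced-rank Δ Δ? r σ ≡ 0 ⊎
    ∃ λ τ → τ ⊆ σ × Δ τ × induced-rank Δ Δ? r σ ≤ r τ
  induced-rank-attained σ = InducedRankFold.fold-attained Δ Δ? r σ (allSubsets n)

module _ {n} {Δ : Subset n → Set} {r : Subset n → ℕ} (sm : IsSemimatroid Δ r) where
  open IsSemimatroid sm
  open IsSimplicialComplex complex

  induced-rank-face : (Δ? : Decidable Δ) → ∀ {σ} → Δ σ → induced-rank Δ Δ? r σ ≡ r σ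
  induced-rank-face Δ? {σ} Δσ with induced-rank-attained Δ Δ? r σ
  ... | inj₁ ρσ≡0 = ≤-antisym (≤-trans (≤-reflexive ρσ≡0) z≤n) (induced-rank-upper Δ Δ? r ⊆-refl Δσ)
  ... | inj₂ (τ , τ⊆σ , Δτ , ρσ≤rτ) =
    ≤-antisym (≤-trans ρσ≤rτ (R2 τ σ Δτ Δσ τ⊆σ)) (induced-rank-upper Δ Δ? r ⊆-refl Δσ)

  same-rank-extension-face : ∀ {σ α β} → σ ⊆ α → σ ⊆ β → Δ α → Δ β → r α ≡ r σ → Δ (α ∪ β)
  same-rank-extension-face {σ} {α} {β} σ⊆α σ⊆β Δα Δβ rα≡rσ = R4 α β Δα Δβ rα≡rα∩β
    where
    Δα∩β : Δ (α ∩ β)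
    Δα∩β = down-closed (p∩q⊆p α β) Δα
    rα≡rα∩β : r α ≡ r (α ∩ β)
    rα≡rα∩β = ≤-antisym
      (≤-trans (≤-reflexive rα≡rσ) (R2 σ (α ∩ β) (down-closed σ⊆α Δα) Δα∩β (∩-glb σ⊆α σ⊆β)))
      (R2 (α ∩ β) α Δα∩β Δα (p∩q⊆p α β))

  module _ (Δ? : Decidable Δ) where
    private
      ρ : Subset n → ℕ
      ρ = induced-rank Δ Δ? r

    rank-increase⇒face : ∀ σ x → Δ σ → x ∉ σ → ρ σ < ρ (σ ∪ ⁅ x ⁆) → Δ (σ ∪ ⁅ x ⁆)
    rank-increase⇒face σ x Δσ _ ρσ<ρσ+x with induced-rank-attained Δ Δ? r (σ ∪ ⁅ x ⁆)
    ... | inj₁ ρσ+x≡0 = contradiction (subst (ρ σ <_) ρσ+x≡0 ρσ<ρσ+x) n≮0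
    ... | inj₂ (τ , τ⊆σ+x , Δτ , ρσ+x≤rτ)
      with R5 σ τ Δσ Δτ (subst (_< r τ) (induced-rank-face Δ? Δσ) (<-≤-trans ρσ<ρσ+x ρσ+x≤rτ))
    ...   | y , y∈τ , y∉σ , Δσ+y with x∈p∪q⁻ σ ⁅ x ⁆ (τ⊆σ+x y∈τ)
    ...     | inj₁ y∈σ   = contradiction y∈σ y∉σ
    ...     | inj₂ y∈⁅x⁆ = subst (λ z → Δ (σ ∪ ⁅ z ⁆)) (x∈⁅y⁆⇒x≡y x y∈⁅x⁆) Δσ+y

    same-rank⇒cone-point : ∀ σ x → Δ σ → x ∉ σ → ρ (σ ∪ ⁅ x ⁆) ≡ ρ σ → Δ (σ ∪ ⁅ x ⁆) →
                           IsConePoint (link Δ σ) x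
    same-rank⇒cone-point σ x Δσ x∉σ ρσ+x≡ρσ Δσ+x τ (τ∩σ≡⊥ , Δτ∪σ) = disjoint , Δτ+x∪σ
      where
      open ≡-Reasoning
      rσ+x≡rσ : r (σ ∪ ⁅ x ⁆) ≡ r σ
      rσ+x≡rσ = begin
        r (σ ∪ ⁅ x ⁆)  ≡⟨ sym (induced-rank-face Δ? Δσ+x) ⟩
        ρ (σ ∪ ⁅ x ⁆)  ≡⟨ ρσ+x≡ρσ ⟩
        ρ σ            ≡⟨ induced-rank-face Δ? Δσ ⟩
        r σ            ∎
      Δσ+x∪τ∪σ : Δ ((σ ∪ ⁅ x ⁆) ∪ (τ ∪ σ))
      Δσ+x∪τ∪σ = same-rank-extension-face (p⊆p∪q ⁅ x ⁆) (q⊆p∪q τ σ) Δσ+x Δτ∪σ rσ+x≡rσ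
      Δτ+x∪σ : Δ ((τ ∪ ⁅ x ⁆) ∪ σ)
      Δτ+x∪σ = down-closed
        (∪-lub (∪-lub (⊆-trans (p⊆p∪q σ) (q⊆p∪q (σ ∪ ⁅ x ⁆) (τ ∪ σ)))
                      (⊆-trans (q⊆p∪q σ ⁅ x ⁆) (p⊆p∪q (τ ∪ σ))))
               (⊆-trans (q⊆p∪q τ σ) (q⊆p∪q (σ ∪ ⁅ x ⁆) (τ ∪ σ))))
        Δσ+x∪τ∪σ
      disjoint : (τ ∪ ⁅ x ⁆) ∩ σ ≡ ⊥
      disjoint = begin
        (τ ∪ ⁅ x ⁆) ∩ σ        ≡⟨ ∩-distribʳ-∪ σ τ ⁅ x ⁆ ⟩
        (τ ∩ σ) ∪ (⁅ x ⁆ ∩ σ)  ≡⟨ cong₂ _∪_ τ∩σ≡⊥ (x∉p⇒⁅x⁆∩p≡⊥ x∉σ) ⟩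
        ⊥ ∪ ⊥                  ≡⟨ ∪-identityˡ ⊥ ⟩
        ⊥                      ∎

theorem5p2 : (n : ℕ) (Δ : Subset n → Set) (Δ? : Decidable Δ) (r : Subset n → ℕ) →
    IsSemimatroid Δ r →
    IsStrongPseudoIndependenceComplex (induced-rank Δ Δ? r) Δ
theorem5p2 n Δ Δ? r sm =
  (IsSemimatroid.complex sm , rank-increase⇒face sm Δ?) , same-rank⇒cone-point sm Δ?
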